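{- Let $G$ be a complete wheel with $n\geq9$ vertices, cycle $C=\{c_1,\dots,c_{n-1}\}$ and central vertex $h$. For $L\subseteq C$, let $b_1b_2\cdots b_{n-1}$ be the cyclic binary string with $b_i=1$ iff $c_i\in L$. Call a binary string of length four invalid if it contains at least three zeroes. Then $L$ is an NL-landmark set for parameter $k=2$ if and only if no four cyclically consecutive bits $b_i b_{i+1}b_{i+2}b_{i+3}$ (indices modulo $n-1$) form an invalid string.
   Context: The complete wheel on $n$ vertices has vertex set $V=C\cup\{h\}$ with $C=\{c_1,\dots,c_{n-1}\}$, edges $\{c_i,h\}$ and $\{c_i,c_{i+1}\}$ for $1\le i\le n-1$, indices modulo $n-1$. $d(x,y)$ denotes graph distance; $\tau$ separates distinct $u,v$ if $d(u,\tau)\neq d(v,\tau)$. $L\subseteq V$ is an NL-landmark set for parameter $k$ if every pair of distinct $u,v\in V\setminus L$ is separated by at least $k$ distinct vertices of $L$. -}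

module Defs where

open import Data.Nat using (ℕ; zero; suc; _+_; _≤_; _<_; _∸_)
open import Data.Nat.DivMod using (_%_; m%n<n)
open import Data.Fin using (Fin; toℕ; fromℕ<)
open import Data.Fin.Subset using (Subset; _∈_; _∉_)
open import Data.Bool using (Bool; true; false)
open import Data.Vec using (lookup)
open import Data.Unit using (⊤; tt)
open import Data.Sum using (_⊎_; inj₁; inj₂)
open import Data.Product using (_×_; Σ; ∃)
open import Data.List using (List; length)
open import Data.List.Relation.Unary.All using (All)
open import Data.List.Relation.Unary.Unique.Propositional using (Unique)
open import Relation.Binary.PropositionalEquality using (_≡_; _≢_)
open import Relation.Nullary using (¬_)

data Walk {V : Set} (Adj : V → V → Set) : V → V → ℕ → Set where
  here : ∀ {u} → Walk Adj u u 0
  step : ∀ {u w v k} → Adj u w → Walk Adj w v k → Walk Adj u v (suc k)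

IsDist : {V : Set} (Adj : V → V → Set) → V → V → ℕ → Set
IsDist Adj u v k = Walk Adj u v k × (∀ j → j < k → ¬ Walk Adj u v j)

Separates : {V : Set} (Adj : V → V → Set) → V → V → V → Set
Separates Adj τ u v = ∀ a b → IsDist Adj u τ a → IsDist Adj v τ b → a ≢ b

IsNLLandmark : {V : Set} (Adj : V → V → Set) (k : ℕ) (L : V → Set) → Set
IsNLLandmark {V} Adj k L =
  ∀ (u v : V) → ¬ L u → ¬ L v → u ≢ v →
    Σ (List V) λ τs → k ≤ length τs × Unique τs × All L τs
                      × All (λ τ → Separates Adj τ u v) τs

-- The complete wheel with n = suc m vertices: cycle c_0..c_{m-1}
-- (inj₁ i, i : Fin m) and hub h (inj₂ tt).

WV : ℕ → Set
WV m = Fin m ⊎ ⊤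

hub : ∀ {m} → WV m
hub = inj₂ tt

CycNext : (m : ℕ) → Fin m → Fin m → Set
CycNext m i j = (toℕ j ≡ suc (toℕ i)) ⊎ ((suc (toℕ i) ≡ m) × (toℕ j ≡ 0))

data WAdj (m : ℕ) : WV m → WV m → Set where
  cyc-fwd : ∀ {i j} → CycNext m i j → WAdj m (inj₁ i) (inj₁ j)
  cyc-bwd : ∀ {i j} → CycNext m j i → WAdj m (inj₁ i) (inj₁ j)
  spoke-out : ∀ {i} → WAdj m (inj₁ i) hub
  spoke-in  : ∀ {i} → WAdj m hub (inj₁ i)

InL : ∀ {m} → Subset m → WV m → Set
InL L (inj₁ i) = i ∈ L
InL L (inj₂ _) = Data.Empty.⊥
  where import Data.Empty

shift : (m : ℕ) → Fin m → ℕ → Fin m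
shift (suc p) i t = fromℕ< (m%n<n (toℕ i + t) (suc p))

bit : ∀ {m} → Subset m → Fin m → Bool
bit L i = lookup L i

zeros : Bool → ℕ
zeros false = 1
zeros true  = 0

Invalid : Bool → Bool → Bool → Bool → Set
Invalid x y z w = 3 ≤ zeros x + zeros y + zeros z + zeros w

NoInvalidWindow : (m : ℕ) → Subset m → Set
NoInvalidWindow m L =
  ∀ (i : Fin m) → ¬ Invalid (bit L (shift m i 0)) (bit L (shift m i 1))
                           (bit L (shift m i 2)) (bit L (shift m i 3))

module Submission where

-- In the wheel with m ≥ 8 rim vertices every rim vertex has distance 1 from
-- the hub, and two distinct rim vertices have distance 1 or 2 according to
-- whether they are neighbours on the rim.  Hence a rim landmark separates the
-- hub from a rim vertex y iff it is not a neighbour of y, and separates two rim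
-- vertices iff it is adjacent to exactly one of them.
--
-- After a few facts about four-bit windows, Landmarks
-- proves both directions:
--   * an invalid window at i yields two non-landmarks near i all of whose
--     separating landmarks sit at one offset, so k = 2 fails;
--   * if all windows are valid, the hub and a rim vertex y are separated by
--     the two ones in the window at offsets 2..5 from y, and two rim vertices
--     at cyclic distance d ≤ m/2 are separated by ones found in the windows
--     around them (separate arguments for d = 1, 2, 3 and d ≥ 4).

open import Defs
open import Data.Bool using (Bool; true; false)
open import Data.Empty using (⊥; ⊥-elim)
open import Data.Fin using (Fin; toℕ)
open import Data.Fin.Properties using (toℕ-fromℕ<; toℕ-injective; toℕ<n)
open import Data.Fin.Subset using (Subset)
open import Data.List using (List; []; _∷_; length)
open import Data.List.Relation.Unary.All using (All; []; _∷_)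
import Data.List.Relation.Unary.All as All
open import Data.List.Relation.Unary.AllPairs using ([]; _∷_)
open import Data.List.Relation.Unary.Unique.Propositional using (Unique)
open import Data.Nat using (ℕ; zero; suc; _+_; _∸_; _≤_; _<_; z≤n; s≤s; _≟_; _<?_; _≤?_)
open import Data.Nat.DivMod using (_%_; %-distribˡ-+; m%n%n≡m%n; [m+n]%n≡m%n; m<n⇒m%n≡m; n%n≡0; m%n<n)
open import Data.Nat.Properties
open import Data.Product using (_×_; Σ; _,_)
open import Data.Sum using (_⊎_; inj₁; inj₂; [_,_])
open import Data.Sum.Properties using (inj₁-injective)
open import Data.Unit using (tt)
open import Data.Vec.Properties using ([]=⇒lookup; lookup⇒[]=)
open import Relation.Binary using (tri<; tri≈; tri>)
open import Relation.Binary.PropositionalEquality using (_≡_; _≢_; refl; sym; trans; cong; subst; subst₂; module ≡-Reasoning)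
open import Relation.Nullary using (¬_; Dec; yes; no)
open import Relation.Nullary.Decidable using (True; toWitness; _⊎-dec_; _×-dec_)

<-lit : ∀ {k n} {k<n : True (k <? n)} → k < n
<-lit {k<n = k<n} = toWitness k<n

module GraphDistance {V : Set} (Adj : V → V → Set) where

  dist-unique : ∀ {u v a b} → IsDist Adj u v a → IsDist Adj u v b → a ≡ b
  dist-unique {a = a} {b} (walk-a , shortest-a) (walk-b , shortest-b) with <-cmp a b
  ... | tri< a<b _ _ = ⊥-elim (shortest-b a a<b walk-a)
  ... | tri≈ _ a≡b _ = a≡b
  ... | tri> _ _ b<a = ⊥-elim (shortest-a b b<a walk-b)

  separated-by : ∀ {τ u v a b} → IsDist Adj u τ a → IsDist Adj v τ b → a ≢ b →
    Separates Adj τ u v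
  separated-by du dv a≢b a′ b′ du′ dv′ a′≡b′ =
    a≢b (trans (dist-unique du du′) (trans a′≡b′ (dist-unique dv′ dv)))

  not-separated-by : ∀ {τ u v a} → IsDist Adj u τ a → IsDist Adj v τ a →
    ¬ Separates Adj τ u v
  not-separated-by du dv sep = sep _ _ du dv refl

  separates-sym : ∀ {τ u v} → Separates Adj τ u v → Separates Adj τ v u
  separates-sym sep a b dv du a≡b = sep b a du dv (sym a≡b)

  dist-one : ∀ {u v} → Adj u v → u ≢ v → IsDist Adj u v 1
  dist-one adj u≢v = step adj here , λ { zero _ here → u≢v refl ; (suc _) (s≤s ()) _ }

  dist-two : ∀ {u v} → Walk Adj u v 2 → ¬ Adj u v → u ≢ v → IsDist Adj u v 2
  dist-two walk ¬adj u≢v = walk , λ { zero _ here → u≢v refl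
                                    ; 1 _ (step adj here) → ¬adj adj
                                    ; (suc (suc _)) (s≤s (s≤s ())) _ }

  SeparatedBy : ℕ → (V → Set) → V → V → Set
  SeparatedBy k L u v = Σ (List V) λ τs → k ≤ length τs × Unique τs × All L τs
                                         × All (λ τ → Separates Adj τ u v) τs

  separatedBy-sym : ∀ {k L u v} → SeparatedBy k L u v → SeparatedBy k L v u
  separatedBy-sym (τs , k≤ , unique , landmarks , seps) =
    τs , k≤ , unique , landmarks , All.map separates-sym seps

  two-separators : ∀ {L : V → Set} {u v τ₁ τ₂} → τ₁ ≢ τ₂ → L τ₁ → L τ₂ →
    Separates Adj τ₁ u v → Separates Adj τ₂ u v → SeparatedBy 2 L u v
  two-separators τ₁≢τ₂ l₁ l₂ s₁ s₂ =
    _ ∷ _ ∷ [] , s≤s (s≤s z≤n) , (τ₁≢τ₂ ∷ []) ∷ [] ∷ [] , l₁ ∷ l₂ ∷ [] , s₁ ∷ s₂ ∷ []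

  unique-separator : ∀ {L : V → Set} {u v} w →
    (∀ τ → L τ → Separates Adj τ u v → τ ≡ w) → ¬ SeparatedBy 2 L u v
  unique-separator w forced ([] , () , _)
  unique-separator w forced (_ ∷ [] , s≤s () , _)
  unique-separator w forced (τ₁ ∷ τ₂ ∷ _ , _ , (τ₁≢τ₂ ∷ _) ∷ _ , l₁ ∷ l₂ ∷ _ , s₁ ∷ s₂ ∷ _) =
    τ₁≢τ₂ (trans (forced τ₁ l₁ s₁) (sym (forced τ₂ l₂ s₂)))

RimAdj : (m : ℕ) → Fin m → Fin m → Set
RimAdj m i j = CycNext m i j ⊎ CycNext m j i

module WheelDistance (m : ℕ) where
  open GraphDistance (WAdj m)

  rim-edge : ∀ {i j} → RimAdj m i j → WAdj m (inj₁ i) (inj₁ j)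
  rim-edge (inj₁ next) = cyc-fwd next
  rim-edge (inj₂ prev) = cyc-bwd prev

  edge-rim : ∀ {i j} → WAdj m (inj₁ i) (inj₁ j) → RimAdj m i j
  edge-rim (cyc-fwd next) = inj₁ next
  edge-rim (cyc-bwd prev) = inj₂ prev

  rimAdj? : ∀ i j → Dec (RimAdj m i j)
  rimAdj? i j = cycNext? i j ⊎-dec cycNext? j i
    where
    cycNext? : ∀ i j → Dec (CycNext m i j)
    cycNext? i j = (toℕ j ≟ suc (toℕ i)) ⊎-dec ((suc (toℕ i) ≟ m) ×-dec (toℕ j ≟ 0))

  hub-dist : ∀ {i} → IsDist (WAdj m) hub (inj₁ i) 1
  hub-dist = dist-one spoke-in (λ ())

  rim-dist-near : ∀ {i j} → RimAdj m i j → i ≢ j → IsDist (WAdj m) (inj₁ i) (inj₁ j) 1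
  rim-dist-near adj i≢j = dist-one (rim-edge adj) (λ { refl → i≢j refl })

  rim-dist-far : ∀ {i j} → ¬ RimAdj m i j → i ≢ j → IsDist (WAdj m) (inj₁ i) (inj₁ j) 2
  rim-dist-far ¬adj i≢j =
    dist-two (step spoke-out (step spoke-in here)) (λ e → ¬adj (edge-rim e)) (λ { refl → i≢j refl })

  separates-hub : ∀ {t y} → ¬ RimAdj m y t → y ≢ t → Separates (WAdj m) (inj₁ t) hub (inj₁ y)
  separates-hub ¬adj y≢t = separated-by hub-dist (rim-dist-far ¬adj y≢t) (λ ())

  separates-rim : ∀ {t x y} → RimAdj m x t → ¬ RimAdj m y t → x ≢ t → y ≢ t →
    Separates (WAdj m) (inj₁ t) (inj₁ x) (inj₁ y)
  separates-rim adj ¬adj x≢t y≢t =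
    separated-by (rim-dist-near adj x≢t) (rim-dist-far ¬adj y≢t) (λ ())

  separator-rim : ∀ {t x y} → x ≢ t → y ≢ t → Separates (WAdj m) (inj₁ t) (inj₁ x) (inj₁ y) →
    (RimAdj m x t × ¬ RimAdj m y t) ⊎ (¬ RimAdj m x t × RimAdj m y t)
  separator-rim {t} {x} {y} x≢t y≢t sep with rimAdj? x t | rimAdj? y t
  ... | yes adj₁ | yes adj₂ =
    ⊥-elim (not-separated-by (rim-dist-near adj₁ x≢t) (rim-dist-near adj₂ y≢t) sep)
  ... | yes adj₁ | no ¬adj₂ = inj₁ (adj₁ , ¬adj₂)
  ... | no ¬adj₁ | yes adj₂ = inj₂ (¬adj₁ , adj₂)
  ... | no ¬adj₁ | no ¬adj₂ =
    ⊥-elim (not-separated-by (rim-dist-far ¬adj₁ x≢t) (rim-dist-far ¬adj₂ y≢t) sep)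

-- Succ m a c: c follows a cyclically on 0..m-1.  By definition
-- CycNext m i j is Succ m (toℕ i) (toℕ j).
Succ : ℕ → ℕ → ℕ → Set
Succ m a c = (c ≡ suc a) ⊎ ((suc a ≡ m) × (c ≡ 0))

OffsetAdj : ℕ → ℕ → ℕ → Set
OffsetAdj m s t = Succ m s t ⊎ Succ m t s

module OffsetAdjacency (m : ℕ) where

  adj-suc : ∀ s → OffsetAdj m s (suc s)
  adj-suc s = inj₁ (inj₁ refl)

  adj-pred : ∀ s → OffsetAdj m (suc s) s
  adj-pred s = inj₂ (inj₁ refl)

  adj-sym : ∀ {s t} → OffsetAdj m s t → OffsetAdj m t s
  adj-sym (inj₁ succ) = inj₂ succ
  adj-sym (inj₂ succ) = inj₁ succ

  adjacent-distinct : ∀ {s t} → 1 < m → OffsetAdj m s t → s ≢ t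
  adjacent-distinct 1<m adj refl = [ no-loop , no-loop ] adj
    where
    no-loop : ∀ {s} → Succ m s s → ⊥
    no-loop (inj₁ s≡1+s) = 1+n≢n (sym s≡1+s)
    no-loop (inj₂ (1≡m , refl)) = <-irrefl 1≡m 1<m

  neighbours : ∀ {r t} → suc (suc r) < m → OffsetAdj m (suc r) t → t ≡ r ⊎ t ≡ suc (suc r)
  neighbours _     (inj₁ (inj₁ t≡r+2))       = inj₂ t≡r+2
  neighbours r+2<m (inj₁ (inj₂ (r+2≡m , _))) = ⊥-elim (<-irrefl r+2≡m r+2<m)
  neighbours _     (inj₂ (inj₁ r+1≡t+1))     = inj₁ (sym (suc-injective r+1≡t+1))
  neighbours _     (inj₂ (inj₂ (_ , ())))

  neighbours-of-zero : ∀ {t} → 1 < m → OffsetAdj m 0 t → t ≡ 1 ⊎ suc t ≡ m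
  neighbours-of-zero _   (inj₁ (inj₁ t≡1))       = inj₁ t≡1
  neighbours-of-zero 1<m (inj₁ (inj₂ (1≡m , _))) = ⊥-elim (<-irrefl 1≡m 1<m)
  neighbours-of-zero _   (inj₂ (inj₁ ()))
  neighbours-of-zero _   (inj₂ (inj₂ (t+1≡m , _))) = inj₂ t+1≡m

  not-adjacent : ∀ {r t} → suc (suc r) < m → t ≢ r → t ≢ suc (suc r) → ¬ OffsetAdj m (suc r) t
  not-adjacent r+2<m t≢r t≢r+2 adj = [ t≢r , t≢r+2 ] (neighbours r+2<m adj)

  AdjacentToOneOf : ℕ → ℕ → ℕ → Set
  AdjacentToOneOf s s′ t = (OffsetAdj m s t × ¬ OffsetAdj m s′ t) ⊎ (¬ OffsetAdj m s t × OffsetAdj m s′ t)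

-- Rim vertices as offsets from a base: shift m b t is the rim vertex t steps after b.
module Rotation (p : ℕ) where
  open ≡-Reasoning

  m : ℕ
  m = suc p

  [a%m+t]%m≡[a+t]%m : ∀ a t → (a % m + t) % m ≡ (a + t) % m
  [a%m+t]%m≡[a+t]%m a t = begin
    (a % m + t) % m          ≡⟨ %-distribˡ-+ (a % m) t m ⟩
    (a % m % m + t % m) % m  ≡⟨ cong (λ z → (z + t % m) % m) (m%n%n≡m%n a m) ⟩
    (a % m + t % m) % m      ≡⟨ sym (%-distribˡ-+ a t m) ⟩
    (a + t) % m              ∎

  [t+a%m]%m≡[t+a]%m : ∀ t a → (t + a % m) % m ≡ (t + a) % m
  [t+a%m]%m≡[t+a]%m t a = begin
    (t + a % m) % m ≡⟨ cong (_% m) (+-comm t (a % m)) ⟩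
    (a % m + t) % m ≡⟨ [a%m+t]%m≡[a+t]%m a t ⟩
    (a + t) % m     ≡⟨ cong (_% m) (+-comm a t) ⟩
    (t + a) % m     ∎

  -- Adding m ∸ b undoes a rotation by b.
  rotate-back : ∀ {b} s → b ≤ m → b + s + (m ∸ b) ≡ s + m
  rotate-back {b} s b≤m = begin
    b + s + (m ∸ b)   ≡⟨ cong (_+ (m ∸ b)) (+-comm b s) ⟩
    s + b + (m ∸ b)   ≡⟨ +-assoc s b (m ∸ b) ⟩
    s + (b + (m ∸ b)) ≡⟨ cong (s +_) (m+[n∸m]≡n b≤m) ⟩
    s + m             ∎

  toℕ-shift : ∀ b t → toℕ (shift m b t) ≡ (toℕ b + t) % m
  toℕ-shift b t = toℕ-fromℕ< _

  shift-cong : ∀ b {s t} → s % m ≡ t % m → shift m b s ≡ shift m b t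
  shift-cong b {s} {t} s≡t = toℕ-injective (begin
    toℕ (shift m b s)   ≡⟨ toℕ-shift b s ⟩
    (toℕ b + s) % m     ≡⟨ sym ([t+a%m]%m≡[t+a]%m (toℕ b) s) ⟩
    (toℕ b + s % m) % m ≡⟨ cong (λ z → (toℕ b + z) % m) s≡t ⟩
    (toℕ b + t % m) % m ≡⟨ [t+a%m]%m≡[t+a]%m (toℕ b) t ⟩
    (toℕ b + t) % m     ≡⟨ sym (toℕ-shift b t) ⟩
    toℕ (shift m b t)   ∎)

  shift-cancel : ∀ b {s t} → shift m b s ≡ shift m b t → s % m ≡ t % m
  shift-cancel b {s} {t} eq = begin
    s % m                                 ≡⟨ sym (unrotate s) ⟩
    (toℕ (shift m b s) + (m ∸ toℕ b)) % m ≡⟨ cong (λ i → (toℕ i + (m ∸ toℕ b)) % m) eq ⟩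
    (toℕ (shift m b t) + (m ∸ toℕ b)) % m ≡⟨ unrotate t ⟩
    t % m                                 ∎
    where
    unrotate : ∀ s → (toℕ (shift m b s) + (m ∸ toℕ b)) % m ≡ s % m
    unrotate s = begin
      (toℕ (shift m b s) + (m ∸ toℕ b)) % m ≡⟨ cong (λ z → (z + (m ∸ toℕ b)) % m) (toℕ-shift b s) ⟩
      ((toℕ b + s) % m + (m ∸ toℕ b)) % m   ≡⟨ [a%m+t]%m≡[a+t]%m (toℕ b + s) (m ∸ toℕ b) ⟩
      (toℕ b + s + (m ∸ toℕ b)) % m         ≡⟨ cong (_% m) (rotate-back s (<⇒≤ (toℕ<n b))) ⟩
      (s + m) % m                           ≡⟨ [m+n]%n≡m%n s m ⟩
      s % m                                 ∎

  shift-injective : ∀ b {s t} → s < m → t < m → shift m b s ≡ shift m b t → s ≡ t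
  shift-injective b s<m t<m eq =
    trans (sym (m<n⇒m%n≡m s<m)) (trans (shift-cancel b eq) (m<n⇒m%n≡m t<m))

  shift-distinct : ∀ b {s t} → s < m → t < m → s ≢ t → shift m b s ≢ shift m b t
  shift-distinct b s<m t<m s≢t eq = s≢t (shift-injective b s<m t<m eq)

  shift-zero : ∀ b → shift m b 0 ≡ b
  shift-zero b = toℕ-injective (begin
    toℕ (shift m b 0) ≡⟨ toℕ-shift b 0 ⟩
    (toℕ b + 0) % m   ≡⟨ cong (_% m) (+-identityʳ (toℕ b)) ⟩
    toℕ b % m         ≡⟨ m<n⇒m%n≡m (toℕ<n b) ⟩
    toℕ b             ∎)

  shift-shift : ∀ b s t → shift m (shift m b s) t ≡ shift m b (s + t)
  shift-shift b s t = toℕ-injective (begin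
    toℕ (shift m (shift m b s) t) ≡⟨ toℕ-shift (shift m b s) t ⟩
    (toℕ (shift m b s) + t) % m   ≡⟨ cong (λ z → (z + t) % m) (toℕ-shift b s) ⟩
    ((toℕ b + s) % m + t) % m     ≡⟨ [a%m+t]%m≡[a+t]%m (toℕ b + s) t ⟩
    (toℕ b + s + t) % m           ≡⟨ cong (_% m) (+-assoc (toℕ b) s t) ⟩
    (toℕ b + (s + t)) % m         ≡⟨ sym (toℕ-shift b (s + t)) ⟩
    toℕ (shift m b (s + t))       ∎)

  shift-surjective : ∀ b x → Σ ℕ λ t → t < m × shift m b t ≡ x
  shift-surjective b x = t , m%n<n (toℕ x + (m ∸ toℕ b)) m , toℕ-injective (begin
    toℕ (shift m b t)                   ≡⟨ toℕ-shift b t ⟩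
    (toℕ b + t) % m                     ≡⟨ [t+a%m]%m≡[t+a]%m (toℕ b) _ ⟩
    (toℕ b + (toℕ x + (m ∸ toℕ b))) % m ≡⟨ cong (_% m) (sym (+-assoc (toℕ b) (toℕ x) _)) ⟩
    (toℕ b + toℕ x + (m ∸ toℕ b)) % m   ≡⟨ cong (_% m) (rotate-back (toℕ x) (<⇒≤ (toℕ<n b))) ⟩
    (toℕ x + m) % m                     ≡⟨ [m+n]%n≡m%n (toℕ x) m ⟩
    toℕ x % m                           ≡⟨ m<n⇒m%n≡m (toℕ<n x) ⟩
    toℕ x                               ∎)
    where
    t : ℕ
    t = (toℕ x + (m ∸ toℕ b)) % m

  -- Stepping back once (by m - 1 = p) and then d + 1 forward is stepping d forward.
  shift-back : ∀ x d → shift m (shift m x p) (suc d) ≡ shift m x d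
  shift-back x d = trans (shift-shift x p (suc d)) (shift-cong x (begin
    (p + suc d) % m ≡⟨ cong (_% m) (trans (+-comm p (suc d)) (sym (+-suc d p))) ⟩
    (d + m) % m     ≡⟨ [m+n]%n≡m%n d m ⟩
    d % m           ∎))

  shift-wrap : ∀ x {d} → d ≤ m → shift m (shift m x d) (m ∸ d) ≡ x
  shift-wrap x {d} d≤m = trans (shift-shift x d (m ∸ d)) (trans (shift-cong x (begin
    (d + (m ∸ d)) % m ≡⟨ cong (_% m) (m+[n∸m]≡n d≤m) ⟩
    m % m             ≡⟨ n%n≡0 m ⟩
    0                 ∎)) (shift-zero x))

  succ⇒≡suc% : ∀ {a c} → c < m → Succ m a c → c ≡ suc a % m
  succ⇒≡suc% c<m (inj₁ refl) = sym (m<n⇒m%n≡m c<m)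
  succ⇒≡suc% _ (inj₂ (1+a≡m , refl)) = sym (trans (cong (_% m) 1+a≡m) (n%n≡0 m))

  ≡suc%⇒succ : ∀ {a c} → a < m → c ≡ suc a % m → Succ m a c
  ≡suc%⇒succ a<m refl with m≤n⇒m<n∨m≡n a<m
  ... | inj₁ 1+a<m = inj₁ (m<n⇒m%n≡m 1+a<m)
  ... | inj₂ 1+a≡m = inj₂ (1+a≡m , trans (cong (_% m) 1+a≡m) (n%n≡0 m))

  toℕ-shift-suc : ∀ b s → toℕ (shift m b (suc s)) ≡ suc (toℕ (shift m b s)) % m
  toℕ-shift-suc b s = begin
    toℕ (shift m b (suc s))     ≡⟨ toℕ-shift b (suc s) ⟩
    (toℕ b + suc s) % m         ≡⟨ cong (_% m) (+-suc (toℕ b) s) ⟩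
    suc (toℕ b + s) % m         ≡⟨ sym ([t+a%m]%m≡[t+a]%m 1 (toℕ b + s)) ⟩
    suc ((toℕ b + s) % m) % m   ≡⟨ cong (λ z → suc z % m) (sym (toℕ-shift b s)) ⟩
    suc (toℕ (shift m b s)) % m ∎

  succ-shift : ∀ b {s t} → t < m → Succ m s t → Succ m (toℕ (shift m b s)) (toℕ (shift m b t))
  succ-shift b {s} {t} t<m succ = ≡suc%⇒succ (toℕ<n _) (begin
    toℕ (shift m b t)           ≡⟨ cong toℕ (shift-cong b t%m≡1+s%m) ⟩
    toℕ (shift m b (suc s))     ≡⟨ toℕ-shift-suc b s ⟩
    suc (toℕ (shift m b s)) % m ∎)
    where
    t%m≡1+s%m : t % m ≡ suc s % m
    t%m≡1+s%m = trans (cong (_% m) (succ⇒≡suc% t<m succ)) (m%n%n≡m%n (suc s) m)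

  shift-succ : ∀ b {s t} → s < m → t < m → Succ m (toℕ (shift m b s)) (toℕ (shift m b t)) → Succ m s t
  shift-succ b {s} {t} s<m t<m succ = ≡suc%⇒succ s<m (begin
    t         ≡⟨ sym (m<n⇒m%n≡m t<m) ⟩
    t % m     ≡⟨ shift-cancel b (toℕ-injective (begin
                   toℕ (shift m b t)           ≡⟨ succ⇒≡suc% (toℕ<n _) succ ⟩
                   suc (toℕ (shift m b s)) % m ≡⟨ sym (toℕ-shift-suc b s) ⟩
                   toℕ (shift m b (suc s))     ∎)) ⟩
    suc s % m ∎)

  rimAdj⇒offsetAdj : ∀ b {s t} → s < m → t < m → RimAdj m (shift m b s) (shift m b t) → OffsetAdj m s t
  rimAdj⇒offsetAdj b s<m t<m (inj₁ succ) = inj₁ (shift-succ b s<m t<m succ)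
  rimAdj⇒offsetAdj b s<m t<m (inj₂ succ) = inj₂ (shift-succ b t<m s<m succ)

  offsetAdj⇒rimAdj : ∀ b {s t} → s < m → t < m → OffsetAdj m s t → RimAdj m (shift m b s) (shift m b t)
  offsetAdj⇒rimAdj b s<m t<m (inj₁ succ) = inj₁ (succ-shift b t<m succ)
  offsetAdj⇒rimAdj b s<m t<m (inj₂ succ) = inj₂ (succ-shift b s<m succ)

three-zeroes : ∀ {n} → 3 ≤ 3 + n
three-zeroes = s≤s (s≤s (s≤s z≤n))

invalid-cases : ∀ {a b c d} → Invalid a b c d →
  (a ≡ false × b ≡ false × c ≡ false) ⊎ (b ≡ false × c ≡ false × d ≡ false) ⊎
  (a ≡ false × c ≡ false × d ≡ false) ⊎ (a ≡ false × b ≡ false × d ≡ false)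
invalid-cases {false} {false} {false} {_}     _ = inj₁ (refl , refl , refl)
invalid-cases {true}  {false} {false} {false} _ = inj₂ (inj₁ (refl , refl , refl))
invalid-cases {false} {true}  {false} {false} _ = inj₂ (inj₂ (inj₁ (refl , refl , refl)))
invalid-cases {false} {false} {true}  {false} _ = inj₂ (inj₂ (inj₂ (refl , refl , refl)))
invalid-cases {true}  {true}  {true}  {true}  ()
invalid-cases {true}  {true}  {true}  {false} (s≤s ())
invalid-cases {true}  {true}  {false} {true}  (s≤s ())
invalid-cases {true}  {true}  {false} {false} (s≤s (s≤s ()))
invalid-cases {true}  {false} {true}  {true}  (s≤s ())
invalid-cases {true}  {false} {true}  {false} (s≤s (s≤s ()))
invalid-cases {true}  {false} {false} {true}  (s≤s (s≤s ()))
invalid-cases {false} {true}  {true}  {true}  (s≤s ())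
invalid-cases {false} {true}  {true}  {false} (s≤s (s≤s ()))
invalid-cases {false} {true}  {false} {true}  (s≤s (s≤s ()))
invalid-cases {false} {false} {true}  {true}  (s≤s (s≤s ()))

valid-two-ones : (f : ℕ → Bool) → ¬ Invalid (f 0) (f 1) (f 2) (f 3) →
  Σ ℕ λ k → Σ ℕ λ k′ → k < k′ × k′ < 4 × f k ≡ true × f k′ ≡ true
valid-two-ones f valid with f 0 in e₀ | f 1 in e₁ | f 2 in e₂ | f 3 in e₃
... | true  | true  | _     | _     = 0 , 1 , <-lit , <-lit , e₀ , e₁
... | true  | false | true  | _     = 0 , 2 , <-lit , <-lit , e₀ , e₂
... | true  | false | false | true  = 0 , 3 , <-lit , <-lit , e₀ , e₃
... | false | true  | true  | _     = 1 , 2 , <-lit , <-lit , e₁ , e₂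
... | false | true  | false | true  = 1 , 3 , <-lit , <-lit , e₁ , e₃
... | false | false | true  | true  = 2 , 3 , <-lit , <-lit , e₂ , e₃
... | true  | false | false | false = ⊥-elim (valid three-zeroes)
... | false | true  | false | false = ⊥-elim (valid three-zeroes)
... | false | false | true  | false = ⊥-elim (valid three-zeroes)
... | false | false | false | _     = ⊥-elim (valid three-zeroes)

valid-zeros₁₂ : ∀ {a b c d} → ¬ Invalid a b c d → b ≡ false → c ≡ false → a ≡ true × d ≡ true
valid-zeros₁₂ {true}  {d = true}  _     refl refl = refl , refl
valid-zeros₁₂ {true}  {d = false} valid refl refl = ⊥-elim (valid three-zeroes)
valid-zeros₁₂ {false}             valid refl refl = ⊥-elim (valid three-zeroes)

valid-zeros₁₃ : ∀ {a b c d} → ¬ Invalid a b c d → b ≡ false → d ≡ false → a ≡ true × c ≡ true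
valid-zeros₁₃ {true}  {c = true}  _     refl refl = refl , refl
valid-zeros₁₃ {true}  {c = false} valid refl refl = ⊥-elim (valid three-zeroes)
valid-zeros₁₃ {false} {c = true}  valid refl refl = ⊥-elim (valid three-zeroes)
valid-zeros₁₃ {false} {c = false} valid refl refl = ⊥-elim (valid three-zeroes)

valid-zeros₀₂ : ∀ {a b c d} → ¬ Invalid a b c d → a ≡ false → c ≡ false → b ≡ true × d ≡ true
valid-zeros₀₂ {b = true}  {d = true}  _     refl refl = refl , refl
valid-zeros₀₂ {b = true}  {d = false} valid refl refl = ⊥-elim (valid three-zeroes)
valid-zeros₀₂ {b = false}             valid refl refl = ⊥-elim (valid three-zeroes)

valid-zeros₀₃ : ∀ {a b c d} → ¬ Invalid a b c d → a ≡ false → d ≡ false → b ≡ true × c ≡ true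
valid-zeros₀₃ {b = true}  {c = true}  _     refl refl = refl , refl
valid-zeros₀₃ {b = true}  {c = false} valid refl refl = ⊥-elim (valid three-zeroes)
valid-zeros₀₃ {b = false} {c = true}  valid refl refl = ⊥-elim (valid three-zeroes)
valid-zeros₀₃ {b = false} {c = false} valid refl refl = ⊥-elim (valid three-zeroes)

valid-zero₁ : ∀ {a b c d} → ¬ Invalid a b c d → b ≡ false → a ≡ true ⊎ c ≡ true
valid-zero₁ {true}              _     _    = inj₁ refl
valid-zero₁ {false} {c = true}  _     _    = inj₂ refl
valid-zero₁ {false} {c = false} valid refl = ⊥-elim (valid three-zeroes)

invalid-cong : ∀ {a a′ b b′ c c′ d d′} → a ≡ a′ → b ≡ b′ → c ≡ c′ → d ≡ d′ →
  Invalid a b c d → Invalid a′ b′ c′ d′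
invalid-cong refl refl refl refl invalid = invalid

module Landmarks (p : ℕ) (8≤m : 8 ≤ suc p) (L : Subset (suc p)) where
  open Rotation p
  open OffsetAdjacency m
  open WheelDistance m
  open GraphDistance (WAdj m)

  small : ∀ k {k<8 : True (k <? 8)} → k < m
  small k {k<8} = ≤-trans (toWitness k<8) 8≤m

  v : Fin m → ℕ → WV m
  v b t = inj₁ (shift m b t)

  bitAt : Fin m → ℕ → Bool
  bitAt b t = bit L (shift m b t)

  v-distinct : ∀ b {s t} → s < m → t < m → s ≢ t → v b s ≢ v b t
  v-distinct b s<m t<m s≢t eq = shift-distinct b s<m t<m s≢t (inj₁-injective eq)

  clash : ∀ {B : Bool} → B ≡ false → B ≡ true → ⊥
  clash refl ()

  one⇒landmark : ∀ {x} → bit L x ≡ true → InL L (inj₁ x)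
  one⇒landmark {x} one = lookup⇒[]= x L one

  zero⇒¬landmark : ∀ {x} → bit L x ≡ false → ¬ InL L (inj₁ x)
  zero⇒¬landmark bit≡0 x∈L = clash bit≡0 ([]=⇒lookup x∈L)

  ¬landmark⇒zero : ∀ {x} → ¬ InL L (inj₁ x) → bit L x ≡ false
  ¬landmark⇒zero {x} x∉L with bit L x in e
  ... | true  = ⊥-elim (x∉L (one⇒landmark e))
  ... | false = refl

  separates-offsets : ∀ b {t s s′} → t < m → s < m → s′ < m → s′ ≢ t →
    OffsetAdj m s t → ¬ OffsetAdj m s′ t → Separates (WAdj m) (v b t) (v b s) (v b s′)
  separates-offsets b t<m s<m s′<m s′≢t adj ¬adj = separates-rim
    (offsetAdj⇒rimAdj b s<m t<m adj) (λ a → ¬adj (rimAdj⇒offsetAdj b s′<m t<m a))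
    (shift-distinct b s<m t<m (adjacent-distinct (small 1) adj)) (shift-distinct b s′<m t<m s′≢t)

  separator-offsets : ∀ b {t s s′} → t < m → s < m → s′ < m → s ≢ t → s′ ≢ t →
    Separates (WAdj m) (v b t) (v b s) (v b s′) → AdjacentToOneOf s s′ t
  separator-offsets b t<m s<m s′<m s≢t s′≢t sep
    with separator-rim (shift-distinct b s<m t<m s≢t) (shift-distinct b s′<m t<m s′≢t) sep
  ... | inj₁ (adj , ¬adj) =
    inj₁ (rimAdj⇒offsetAdj b s<m t<m adj , λ a → ¬adj (offsetAdj⇒rimAdj b s′<m t<m a))
  ... | inj₂ (¬adj , adj) =
    inj₂ ((λ a → ¬adj (offsetAdj⇒rimAdj b s<m t<m a)) , rimAdj⇒offsetAdj b s′<m t<m adj)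

  module InvalidWindow (landmarks : IsNLLandmark (WAdj m) 2 (InL L)) (i : Fin m) where

    bits-differ : ∀ {s t} → bitAt i s ≡ false → bitAt i t ≡ true → s ≢ t
    bits-differ bit≡0 bit≡1 refl = clash bit≡0 bit≡1

    one-separator-only : ∀ {s s′} w → s < m → s′ < m → s ≢ s′ →
      bitAt i s ≡ false → bitAt i s′ ≡ false →
      (∀ {t} → bitAt i t ≡ true → AdjacentToOneOf s s′ t → t ≡ w) → ⊥
    one-separator-only {s} {s′} w s<m s′<m s≢s′ z z′ forced =
      unique-separator (v i w) at-w
        (landmarks (v i s) (v i s′) (zero⇒¬landmark z) (zero⇒¬landmark z′) (v-distinct i s<m s′<m s≢s′))
      where
      at-w : ∀ τ → InL L τ → Separates (WAdj m) τ (v i s) (v i s′) → τ ≡ v i w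
      at-w (inj₁ x) x∈L sep with shift-surjective i x
      ... | t , t<m , refl = cong (v i) (forced one
              (separator-offsets i t<m s<m s′<m (bits-differ z one) (bits-differ z′ one) sep))
        where
        one : bitAt i t ≡ true
        one = []=⇒lookup x∈L

    zeros-012 : bitAt i 0 ≡ false → bitAt i 1 ≡ false → bitAt i 2 ≡ false → ⊥
    zeros-012 z₀ z₁ z₂ = one-separator-only 3 (small 1) (small 2) (λ ()) z₁ z₂ forced
      where
      forced : ∀ {t} → bitAt i t ≡ true → AdjacentToOneOf 1 2 t → t ≡ 3
      forced one (inj₁ (adj , _)) with neighbours (small 2) adj
      ... | inj₁ refl = ⊥-elim (clash z₀ one)
      ... | inj₂ refl = ⊥-elim (clash z₂ one)
      forced one (inj₂ (_ , adj)) with neighbours (small 3) adj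
      ... | inj₁ refl = ⊥-elim (clash z₁ one)
      ... | inj₂ t≡3  = t≡3

    zeros-123 : bitAt i 1 ≡ false → bitAt i 2 ≡ false → bitAt i 3 ≡ false → ⊥
    zeros-123 z₁ z₂ z₃ = one-separator-only 0 (small 1) (small 2) (λ ()) z₁ z₂ forced
      where
      forced : ∀ {t} → bitAt i t ≡ true → AdjacentToOneOf 1 2 t → t ≡ 0
      forced one (inj₁ (adj , _)) with neighbours (small 2) adj
      ... | inj₁ t≡0  = t≡0
      ... | inj₂ refl = ⊥-elim (clash z₂ one)
      forced one (inj₂ (_ , adj)) with neighbours (small 3) adj
      ... | inj₁ refl = ⊥-elim (clash z₁ one)
      ... | inj₂ refl = ⊥-elim (clash z₃ one)

    zeros-023 : bitAt i 0 ≡ false → bitAt i 2 ≡ false → bitAt i 3 ≡ false → ⊥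
    zeros-023 z₀ z₂ z₃ = one-separator-only p (small 0) (small 2) (λ ()) z₀ z₂ forced
      where
      forced : ∀ {t} → bitAt i t ≡ true → AdjacentToOneOf 0 2 t → t ≡ p
      forced one (inj₁ (adj , ¬adj)) with neighbours-of-zero (small 1) adj
      ... | inj₁ refl   = ⊥-elim (¬adj (adj-pred 1))
      ... | inj₂ 1+t≡m  = suc-injective 1+t≡m
      forced one (inj₂ (¬adj , adj)) with neighbours (small 3) adj
      ... | inj₁ refl = ⊥-elim (¬adj (adj-suc 0))
      ... | inj₂ refl = ⊥-elim (clash z₃ one)

    zeros-013 : bitAt i 0 ≡ false → bitAt i 1 ≡ false → bitAt i 3 ≡ false → ⊥
    zeros-013 z₀ z₁ z₃ = one-separator-only 4 (small 1) (small 3) (λ ()) z₁ z₃ forced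
      where
      forced : ∀ {t} → bitAt i t ≡ true → AdjacentToOneOf 1 3 t → t ≡ 4
      forced one (inj₁ (adj , ¬adj)) with neighbours (small 2) adj
      ... | inj₁ refl = ⊥-elim (clash z₀ one)
      ... | inj₂ refl = ⊥-elim (¬adj (adj-pred 2))
      forced one (inj₂ (¬adj , adj)) with neighbours (small 4) adj
      ... | inj₁ refl = ⊥-elim (¬adj (adj-suc 1))
      ... | inj₂ t≡4  = t≡4

    not-invalid : ¬ Invalid (bitAt i 0) (bitAt i 1) (bitAt i 2) (bitAt i 3)
    not-invalid invalid with invalid-cases invalid
    ... | inj₁ (z₀ , z₁ , z₂)                = zeros-012 z₀ z₁ z₂
    ... | inj₂ (inj₁ (z₁ , z₂ , z₃))         = zeros-123 z₁ z₂ z₃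
    ... | inj₂ (inj₂ (inj₁ (z₀ , z₂ , z₃)))  = zeros-023 z₀ z₂ z₃
    ... | inj₂ (inj₂ (inj₂ (z₀ , z₁ , z₃)))  = zeros-013 z₀ z₁ z₃

  landmark⇒valid : IsNLLandmark (WAdj m) 2 (InL L) → NoInvalidWindow m L
  landmark⇒valid landmarks i = InvalidWindow.not-invalid landmarks i

  module ValidWindows (valid : NoInvalidWindow m L) where

    window : ∀ b s → ¬ Invalid (bitAt b s) (bitAt b (1 + s)) (bitAt b (2 + s)) (bitAt b (3 + s))
    window b s invalid = valid (shift m b s)
      (invalid-cong (sym (relocate 0)) (sym (relocate 1)) (sym (relocate 2)) (sym (relocate 3)) invalid)
      where
      relocate : ∀ k → bit L (shift m (shift m b s) k) ≡ bitAt b (k + s)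
      relocate k = cong (bit L) (trans (shift-shift b s k) (cong (shift m b) (+-comm s k)))

    -- The hub and a rim vertex y: the ones at offsets 2..5 from y are not neighbours of y.
    hub-pair : ∀ y → SeparatedBy 2 (InL L) hub (inj₁ y)
    hub-pair y with valid-two-ones (λ k → bitAt y (2 + k)) (window y 2)
    ... | k , k′ , k<k′ , k′<4 , one , one′ =
      subst (λ x → SeparatedBy 2 (InL L) hub (inj₁ x)) (shift-zero y)
        (two-separators (v-distinct y (offset<m k<4) (offset<m k′<4) 2+k≢2+k′)
           (one⇒landmark one) (one⇒landmark one′) (not-neighbour k<4) (not-neighbour k′<4))
      where
      k<4 : k < 4
      k<4 = <-trans k<k′ k′<4

      2+k≢2+k′ : 2 + k ≢ 2 + k′
      2+k≢2+k′ eq = <⇒≢ k<k′ (+-cancelˡ-≡ 2 k k′ eq)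

      3+offset<m : ∀ {j} → j < 4 → 3 + j < m
      3+offset<m j<4 = ≤-trans (s≤s (s≤s (s≤s j<4))) (≤-trans (n≤1+n 7) 8≤m)

      offset<m : ∀ {j} → j < 4 → 2 + j < m
      offset<m j<4 = <-trans (n<1+n _) (3+offset<m j<4)

      not-neighbour : ∀ {j} → j < 4 → Separates (WAdj m) (v y (2 + j)) hub (v y 0)
      not-neighbour j<4 = separates-hub
        (λ a → not-adjacent (3+offset<m j<4) (λ ()) (λ ())
                 (adj-sym (rimAdj⇒offsetAdj y (small 0) (offset<m j<4) a)))
        (shift-distinct y (small 0) (offset<m j<4) (λ ()))

    gap-1 : ∀ b → bitAt b 1 ≡ false → bitAt b 2 ≡ false → SeparatedBy 2 (InL L) (v b 1) (v b 2)
    gap-1 b z₁ z₂ with valid-zeros₁₂ (window b 0) z₁ z₂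
    ... | one₀ , one₃ =
      two-separators (v-distinct b (small 0) (small 3) (λ ())) (one⇒landmark one₀) (one⇒landmark one₃)
        (separates-offsets b (small 0) (small 1) (small 2) (λ ()) (adj-pred 0)
           (not-adjacent (small 3) (λ ()) (λ ())))
        (separates-sym (separates-offsets b (small 3) (small 2) (small 1) (λ ()) (adj-suc 2)
           (not-adjacent (small 2) (λ ()) (λ ()))))

    gap-2 : ∀ b → bitAt b 1 ≡ false → bitAt b 3 ≡ false → SeparatedBy 2 (InL L) (v b 1) (v b 3)
    gap-2 b z₁ z₃ with valid-zeros₁₃ (window b 0) z₁ z₃ | valid-zeros₀₂ (window b 1) z₁ z₃
    ... | one₀ , _ | _ , one₄ =
      two-separators (v-distinct b (small 0) (small 4) (λ ())) (one⇒landmark one₀) (one⇒landmark one₄)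
        (separates-offsets b (small 0) (small 1) (small 3) (λ ()) (adj-pred 0)
           (not-adjacent (small 4) (λ ()) (λ ())))
        (separates-sym (separates-offsets b (small 4) (small 3) (small 1) (λ ()) (adj-suc 3)
           (not-adjacent (small 2) (λ ()) (λ ()))))

    gap-3 : ∀ b → bitAt b 1 ≡ false → bitAt b 4 ≡ false → SeparatedBy 2 (InL L) (v b 1) (v b 4)
    gap-3 b z₁ z₄ with valid-zeros₀₃ (window b 1) z₁ z₄
    ... | one₂ , one₃ =
      two-separators (v-distinct b (small 2) (small 3) (λ ())) (one⇒landmark one₂) (one⇒landmark one₃)
        (separates-offsets b (small 2) (small 1) (small 4) (λ ()) (adj-suc 1)
           (not-adjacent (small 5) (λ ()) (λ ())))
        (separates-sym (separates-offsets b (small 3) (small 4) (small 1) (λ ()) (adj-pred 3)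
           (not-adjacent (small 2) (λ ()) (λ ()))))

    -- For d = e + 4 ≥ 4 each vertex has a landmark neighbour, adjacent only to it.
    gap-far : ∀ b e → (4 + e) + (4 + e) ≤ m → bitAt b 1 ≡ false → bitAt b (5 + e) ≡ false →
      SeparatedBy 2 (InL L) (v b 1) (v b (5 + e))
    gap-far b e 2d≤m z₁ z₁₊d = combine (near (valid-zero₁ (window b 0) z₁)) (far (valid-zero₁ (window b d) z₁₊d))
      where
      d : ℕ
      d = 4 + e

      3≤d : 3 ≤ d
      3≤d = s≤s (s≤s (s≤s z≤n))

      d+2<m : suc (suc d) < m
      d+2<m = ≤-trans (≤-reflexive (+-comm 3 d)) (≤-trans (+-monoʳ-≤ d 3≤d) 2d≤m)

      d+1<m : suc d < m
      d+1<m = <-trans (n<1+n _) d+2<m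

      d<m : d < m
      d<m = <-trans (n<1+n _) d+1<m

      Separator : ℕ → Set
      Separator t = t < m × bitAt b t ≡ true × Separates (WAdj m) (v b t) (v b 1) (v b (suc d))

      near : bitAt b 0 ≡ true ⊎ bitAt b 2 ≡ true → Σ ℕ λ t → t < 3 × Separator t
      near (inj₁ one₀) = 0 , <-lit , small 0 , one₀ ,
        separates-offsets b (small 0) (small 1) d+1<m (λ ()) (adj-pred 0) (not-adjacent d+2<m (λ ()) (λ ()))
      near (inj₂ one₂) = 2 , <-lit , small 2 , one₂ ,
        separates-offsets b (small 2) (small 1) d+1<m (λ ()) (adj-suc 1) (not-adjacent d+2<m (λ ()) (λ ()))

      far : bitAt b d ≡ true ⊎ bitAt b (suc (suc d)) ≡ true → Σ ℕ λ t → d ≤ t × Separator t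
      far (inj₁ one₋) = d , ≤-refl , d<m , one₋ , separates-sym
        (separates-offsets b d<m d+1<m (small 1) (λ ()) (adj-pred d) (not-adjacent (small 2) (λ ()) (λ ())))
      far (inj₂ one₊) = suc (suc d) , m≤n+m d 2 , d+2<m , one₊ , separates-sym
        (separates-offsets b d+2<m d+1<m (small 1) (λ ()) (adj-suc (suc d)) (not-adjacent (small 2) (λ ()) (λ ())))

      combine : (Σ ℕ λ t → t < 3 × Separator t) → (Σ ℕ λ t → d ≤ t × Separator t) →
        SeparatedBy 2 (InL L) (v b 1) (v b (suc d))
      combine (t , t<3 , t<m , one , sep) (t′ , d≤t′ , t′<m , one′ , sep′) =
        two-separators (v-distinct b t<m t′<m (<⇒≢ (<-≤-trans t<3 (≤-trans 3≤d d≤t′))))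
          (one⇒landmark one) (one⇒landmark one′) sep sep′

    close-pair : ∀ b d → 1 ≤ d → d + d ≤ m → bitAt b 1 ≡ false → bitAt b (suc d) ≡ false →
      SeparatedBy 2 (InL L) (v b 1) (v b (suc d))
    close-pair b 1 _ _ = gap-1 b
    close-pair b 2 _ _ = gap-2 b
    close-pair b 3 _ _ = gap-3 b
    close-pair b (suc (suc (suc (suc e)))) _ 2d≤m = gap-far b e 2d≤m

    -- Non-landmarks x and y = x + d with 1 ≤ d ≤ m / 2, seen from the base x - 1.
    rim-pair-at : ∀ x y d → shift m x d ≡ y → 1 ≤ d → d + d ≤ m →
      ¬ InL L (inj₁ x) → ¬ InL L (inj₁ y) → SeparatedBy 2 (InL L) (inj₁ x) (inj₁ y)
    rim-pair-at x y d x+d≡y 1≤d 2d≤m x∉L y∉L =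
      subst₂ (SeparatedBy 2 (InL L)) (cong inj₁ x-at-1) (cong inj₁ y-at-d+1)
        (close-pair b d 1≤d 2d≤m (zero-at x-at-1 x∉L) (zero-at y-at-d+1 y∉L))
      where
      b : Fin m
      b = shift m x p

      x-at-1 : shift m b 1 ≡ x
      x-at-1 = trans (shift-back x 0) (shift-zero x)

      y-at-d+1 : shift m b (suc d) ≡ y
      y-at-d+1 = trans (shift-back x d) x+d≡y

      zero-at : ∀ {t z} → shift m b t ≡ z → ¬ InL L (inj₁ z) → bitAt b t ≡ false
      zero-at refl z∉L = ¬landmark⇒zero z∉L

    -- Two distinct rim non-landmarks: measure the gap in the shorter direction.
    rim-pair : ∀ x y → ¬ InL L (inj₁ x) → ¬ InL L (inj₁ y) → x ≢ y →
      SeparatedBy 2 (InL L) (inj₁ x) (inj₁ y)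
    rim-pair x y x∉L y∉L x≢y with shift-surjective x y
    ... | zero , _ , x+0≡y = ⊥-elim (x≢y (trans (sym (shift-zero x)) x+0≡y))
    ... | d@(suc _) , d<m , x+d≡y with d + d ≤? m
    ...   | yes 2d≤m = rim-pair-at x y d x+d≡y (s≤s z≤n) 2d≤m x∉L y∉L
    ...   | no 2d≰m  = separatedBy-sym (rim-pair-at y x k y+k≡x (m<n⇒0<n∸m d<m) 2k≤m y∉L x∉L)
      where
      k : ℕ
      k = m ∸ d

      y+k≡x : shift m y k ≡ x
      y+k≡x = subst (λ z → shift m z k ≡ x) x+d≡y (shift-wrap x (<⇒≤ d<m))

      2k≤m : k + k ≤ m
      2k≤m = ≤-trans (+-monoʳ-≤ k (m≤n+o⇒m∸n≤o m d (<⇒≤ (≰⇒> 2d≰m))))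
                     (≤-reflexive (m∸n+n≡m (<⇒≤ d<m)))

    valid⇒landmark : IsNLLandmark (WAdj m) 2 (InL L)
    valid⇒landmark (inj₂ tt) (inj₂ tt) _   _   h≢h = ⊥-elim (h≢h refl)
    valid⇒landmark (inj₂ tt) (inj₁ y)  _   _   _   = hub-pair y
    valid⇒landmark (inj₁ x)  (inj₂ tt) _   _   _   = separatedBy-sym (hub-pair x)
    valid⇒landmark (inj₁ x)  (inj₁ y)  x∉L y∉L x≢y = rim-pair x y x∉L y∉L (λ x≡y → x≢y (cong inj₁ x≡y))

mainTheorem20 : (m : ℕ) → 9 ≤ suc m → (L : Subset m) →
    (IsNLLandmark (WAdj m) 2 (InL L) → NoInvalidWindow m L)
      × (NoInvalidWindow m L → IsNLLandmark (WAdj m) 2 (InL L))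
mainTheorem20 zero (s≤s ()) L
mainTheorem20 (suc p) (s≤s 8≤m) L = landmark⇒valid , ValidWindows.valid⇒landmark
  where open Landmarks p 8≤m L
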